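{- Let $\mathcal{G}$ be a class of graphs of bounded expansion. Then there exists a constant $c=c(\mathcal{G})$ such that for every graph $G\in\mathcal{G}$ and every positive integer $r$ we have $\chi_r(G)\leq c\cdot r$.
   Context: A class $\mathcal{G}$ of finite graphs has bounded expansion if (equivalently, by a characterization of Zhu) for every integer $t\geq 1$ there is a constant $d(t)$ with $\operatorname{col}_t(G)\leq d(t)$ for all $G\in\mathcal{G}$. Here, for a linear order $\pi$ of $V(G)$, a vertex $u$ is $t$-accessible from $v$ if $u\leq v$ in $\pi$ and there is a $u$–$v$ path of length at most $t$ all of whose inner vertices $w$ satisfy $v<w$; $\mathrm{Reach}_t(v,\pi)$ is the set of such $u$ (including $v$), and $\operatorname{col}_t(G)=\min_\pi\max_v|\mathrm{Reach}_t(v,\pi)|$. For an integer $r\ge0$, an $r$-dynamic coloring of $G$ is a proper vertex coloring $\varphi$ such that every vertex $v$ satisfies $|\varphi(N_G(v))|\geq\min(r,\deg_G(v))$; $\chi_r(G)$ is the minimum number of colors in an $r$-dynamic coloring. -}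

module Defs where

open import Data.Nat using (ℕ; suc; _≤_; _<_; _*_; _⊓_)
open import Data.Fin using (Fin; toℕ; _≟_)
open import Data.Fin.Properties using (any?)
open import Data.Fin.Subset using (Subset; _∈_; ∣_∣)
open import Data.Fin.Permutation using (Permutation′; _⟨$⟩ʳ_)
open import Data.Bool using (Bool; true; false)
open import Data.Bool.Properties renaming (_≟_ to _≟ᵇ_)
open import Data.Vec using (tabulate)
open import Data.List using (List; []; _∷_; _∷ʳ_; length)
open import Data.List.Relation.Unary.All using (All)
open import Data.List.Relation.Unary.Linked using (Linked)
open import Data.List.Relation.Unary.Unique.Propositional using (Unique)
open import Data.Product using (Σ; ∃; _×_; _,_)
open import Data.Sum using (_⊎_)
open import Relation.Nullary using (¬_)
open import Relation.Nullary.Decidable using (⌊_⌋; _×-dec_)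
open import Relation.Binary.PropositionalEquality using (_≡_; _≢_)

record Graph : Set where
  field
    n      : ℕ
    adj    : Fin n → Fin n → Bool
    sym    : ∀ u v → adj u v ≡ adj v u
    irrefl : ∀ v → adj v v ≡ false

open Graph public

Vertex : Graph → Set
Vertex G = Fin (n G)

Adj : (G : Graph) → Vertex G → Vertex G → Set
Adj G u v = adj G u v ≡ true

CardAtMost : {m : ℕ} → (Fin m → Set) → ℕ → Set
CardAtMost {m} P d = Σ (Subset m) λ S → (∀ u → P u → u ∈ S) × ∣ S ∣ ≤ d

-- Linear orders on V(G): a permutation giving the position of each vertex.
LinOrder : Graph → Set
LinOrder G = Permutation′ (n G)

_≤[_]_ : {G : Graph} → Vertex G → LinOrder G → Vertex G → Set
u ≤[ π ] v = toℕ (π ⟨$⟩ʳ u) ≤ toℕ (π ⟨$⟩ʳ v)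

_<[_]_ : {G : Graph} → Vertex G → LinOrder G → Vertex G → Set
u <[ π ] v = toℕ (π ⟨$⟩ʳ u) < toℕ (π ⟨$⟩ʳ v)

-- A u–v path of length at most t all of whose inner vertices w satisfy v <π w.
-- For u ≢ v the path is  u ∷ inner ∷ʳ v  (length = length inner + 1);
-- for u ≡ v it is the trivial path of length 0.
ReachPath : (G : Graph) → LinOrder G → ℕ → Vertex G → Vertex G → Set
ReachPath G π t u v =
  Σ (List (Vertex G)) λ inner →
      Unique (u ∷ inner ∷ʳ v)
    × Linked (Adj G) (u ∷ inner ∷ʳ v)
    × suc (length inner) ≤ t
    × All (λ w → _<[_]_ {G} v π w) inner

-- u ∈ Reach_t(v, π)
Reach : (G : Graph) → LinOrder G → ℕ → Vertex G → Vertex G → Set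
Reach G π t v u = _≤[_]_ {G} u π v × (u ≡ v ⊎ ReachPath G π t u v)

ColAtMost : ℕ → Graph → ℕ → Set
ColAtMost t G d = Σ (LinOrder G) λ π → ∀ v → CardAtMost (Reach G π t v) d

-- Bounded expansion (via Zhu's characterization, the paper's definition).
BoundedExpansion : (Graph → Set) → Set
BoundedExpansion 𝒢 = ∀ (t : ℕ) → 1 ≤ t → ∃ λ d → ∀ G → 𝒢 G → ColAtMost t G d

deg : (G : Graph) → Vertex G → ℕ
deg G v = ∣ tabulate (adj G v) ∣

neighbourColours : (G : Graph) {k : ℕ} → (Vertex G → Fin k) → Vertex G → Subset k
neighbourColours G φ v =
  tabulate λ c → ⌊ any? (λ w → (adj G v w ≟ᵇ true) ×-dec (φ w ≟ c)) ⌋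

Proper : (G : Graph) {k : ℕ} → (Vertex G → Fin k) → Set
Proper G φ = ∀ u v → Adj G u v → φ u ≢ φ v

IsDynamic : ℕ → (G : Graph) {k : ℕ} → (Vertex G → Fin k) → Set
IsDynamic r G φ = Proper G φ × (∀ v → r ⊓ deg G v ≤ ∣ neighbourColours G φ v ∣)

ChiDynAtMost : ℕ → Graph → ℕ → Set
ChiDynAtMost r G m = Σ ℕ λ k → k ≤ m × Σ (Vertex G → Fin k) λ φ → IsDynamic r G φ

{-# OPTIONS --safe #-}
-- Fix an order π with |Reach₂(v, π)| ≤ d for all v and let every vertex v select
-- min(r, deg v) of its neighbours. Colour greedily along π, giving w a colour
-- different from those of the earlier vertices of Reach₂(w) and of the earlier vertices
-- selected by members of Reach₂(w); at most d(r + 1) colours are forbidden.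
-- Adjacent vertices are separated because the earlier one lies in Reach₂ of the later.
-- If u <π w are both selected by v, then either v <π w, so v ∈ Reach₂(w), or w <π v,
-- and the path u v w puts u into Reach₂(w). So the selected neighbours of v receive
-- distinct colours, and d(r + 1) + 1 ≤ (2d + 1) r.
module Submission where

open import Defs hiding (sym)
open import Data.Nat using (ℕ; zero; suc; _+_; _*_; _⊓_; _≤_; _<_; z≤n; s≤s; >-nonZero; _≟_)
open import Data.Nat.Properties
open import Data.Fin as Fin using (Fin; toℕ)
open import Data.Fin.Properties using (toℕ-injective; toℕ<n; any?; ¬∀⟶∃¬; pigeonhole)
import Data.Fin.Properties as Finₚ
open import Data.Fin.Subset using (Subset; ∣_∣; _-_) renaming (_∈_ to _∈ₛ_)
open import Data.Fin.Permutation using (_⟨$⟩ʳ_; _⟨$⟩ˡ_; inverseˡ)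
open import Data.Fin.Subset.Properties using (x∈p∧x≢y⇒x∈p-y; x∈p⇒∣p-x∣<∣p∣)
open import Data.Bool using (true; false) renaming (_≟_ to _≟ᵇ_)
open import Data.Vec using ([]; _∷_; tabulate; lookup; here; there)
open import Data.Vec.Properties using ([]=⇒lookup; lookup⇒[]=; lookup∘tabulate)
open import Data.List as List using (List; []; _∷_; _++_; length; map; concatMap)
open import Data.List.Properties using (length-++; length-map)
open import Data.List.Membership.Propositional using (_∈_; _∉_; lose)
open import Data.List.Membership.Propositional.Properties using (∈-map⁺; ∈-concatMap⁺)
import Data.List.Membership.DecPropositional as DecMembership
open import Data.List.Relation.Unary.Any using (here; there; index)
open import Data.List.Relation.Unary.Any.Properties using (lookup-index)
open import Data.List.Relation.Unary.All using ([]; _∷_)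
open import Data.List.Relation.Unary.AllPairs using ([]; _∷_)
open import Data.List.Relation.Unary.Linked using ([-]; _∷_)
open import Data.Product using (∃; _×_; _,_; proj₁; proj₂)
open import Data.Sum using (inj₁; inj₂)
open import Data.Empty using (⊥-elim)
open import Relation.Nullary using (Dec; yes; no)
open import Relation.Nullary.Decidable using (⌊_⌋; does; isYes≗does; dec-true; _×-dec_)
open import Relation.Binary.Definitions using (tri<; tri≈; tri>)
open import Relation.Binary.PropositionalEquality
  using (_≡_; _≢_; refl; sym; trans; cong; subst; ≢-sym; module ≡-Reasoning)
open import Function using (_∘_)

toList : ∀ {m} → Subset m → List (Fin m)
toList []          = []
toList (true  ∷ p) = Fin.zero ∷ map Fin.suc (toList p)
toList (false ∷ p) = map Fin.suc (toList p)

length-toList : ∀ {m} (p : Subset m) → length (toList p) ≡ ∣ p ∣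
length-toList []          = refl
length-toList (true  ∷ p) = cong suc (trans (length-map Fin.suc (toList p)) (length-toList p))
length-toList (false ∷ p) = trans (length-map Fin.suc (toList p)) (length-toList p)

∈-toList⁺ : ∀ {m} (p : Subset m) {x} → x ∈ₛ p → x ∈ toList p
∈-toList⁺ (true  ∷ p) here      = here refl
∈-toList⁺ (true  ∷ p) (there x) = there (∈-map⁺ Fin.suc (∈-toList⁺ p x))
∈-toList⁺ (false ∷ p) (there x) = ∈-map⁺ Fin.suc (∈-toList⁺ p x)

first : ∀ {m} → ℕ → Subset m → Subset m
first _       []          = []
first zero    (_     ∷ p) = false ∷ first zero p
first (suc b) (true  ∷ p) = true ∷ first b p
first (suc b) (false ∷ p) = false ∷ first (suc b) p

first-⊆ : ∀ {m} b (p : Subset m) {x} → x ∈ₛ first b p → x ∈ₛ p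
first-⊆ zero    (_     ∷ p) (there x) = there (first-⊆ zero p x)
first-⊆ (suc b) (true  ∷ p) here      = here
first-⊆ (suc b) (true  ∷ p) (there x) = there (first-⊆ b p x)
first-⊆ (suc b) (false ∷ p) (there x) = there (first-⊆ (suc b) p x)

∣first∣≡ : ∀ {m} b (p : Subset m) → ∣ first b p ∣ ≡ b ⊓ ∣ p ∣
∣first∣≡ b       []          = sym (⊓-zeroʳ b)
∣first∣≡ zero    (_     ∷ p) = ∣first∣≡ zero p
∣first∣≡ (suc b) (true  ∷ p) = cong suc (∣first∣≡ b p)
∣first∣≡ (suc b) (false ∷ p) = ∣first∣≡ (suc b) p

injectiveOn⇒∣p∣≤∣q∣ : ∀ {m k} (p : Subset m) (q : Subset k) (f : Fin m → Fin k) →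
  (∀ {x} → x ∈ₛ p → f x ∈ₛ q) →
  (∀ {x y} → x ∈ₛ p → y ∈ₛ p → f x ≡ f y → x ≡ y) →
  ∣ p ∣ ≤ ∣ q ∣
injectiveOn⇒∣p∣≤∣q∣ [] q f _ _ = z≤n
injectiveOn⇒∣p∣≤∣q∣ (false ∷ p) q f maps inj =
  injectiveOn⇒∣p∣≤∣q∣ p q (f ∘ Fin.suc) (maps ∘ there)
    (λ x y → Finₚ.suc-injective ∘ inj (there x) (there y))
injectiveOn⇒∣p∣≤∣q∣ (true ∷ p) q f maps inj = begin-strict
  ∣ p ∣              ≤⟨ injectiveOn⇒∣p∣≤∣q∣ p (q - f Fin.zero) (f ∘ Fin.suc) maps-into-q-f0
                          (λ x y → Finₚ.suc-injective ∘ inj (there x) (there y)) ⟩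
  ∣ q - f Fin.zero ∣ <⟨ x∈p⇒∣p-x∣<∣p∣ (maps here) ⟩
  ∣ q ∣              ∎
  where
  open ≤-Reasoning
  maps-into-q-f0 : ∀ {x} → x ∈ₛ p → f (Fin.suc x) ∈ₛ q - f Fin.zero
  maps-into-q-f0 x = x∈p∧x≢y⇒x∈p-y (maps (there x)) (Finₚ.0≢1+n ∘ inj here (there x) ∘ sym)

length-concatMap-≤ : ∀ {A B : Set} (f : A → List B) {k} → (∀ x → length (f x) ≤ k) →
  ∀ xs → length (concatMap f xs) ≤ length xs * k
length-concatMap-≤ f         |f|≤k []       = z≤n
length-concatMap-≤ f {k} |f|≤k (x ∷ xs) = begin
  length (f x ++ concatMap f xs)         ≡⟨ length-++ (f x) ⟩
  length (f x) + length (concatMap f xs) ≤⟨ +-mono-≤ (|f|≤k x) (length-concatMap-≤ f |f|≤k xs) ⟩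
  k + length xs * k                      ∎
  where open ≤-Reasoning

-- A list of at most D colours cannot cover Fin (suc D): otherwise the position of each
-- colour in the list would be an injection Fin (suc D) → Fin D.
freshColour : ∀ {D} (xs : List (Fin (suc D))) → length xs ≤ D → ∃ λ c → c ∉ xs
freshColour {D} xs |xs|≤D = ¬∀⟶∃¬ (suc D) (_∈ xs) (_∈? xs) λ covered →
  let i , j , i<j , same = pigeonhole (s≤s |xs|≤D) (index ∘ covered) in
  Finₚ.<⇒≢ i<j (begin
    i                                  ≡⟨ lookup-index (covered i) ⟩
    List.lookup xs (index (covered i)) ≡⟨ cong (List.lookup xs) same ⟩
    List.lookup xs (index (covered j)) ≡⟨ lookup-index (covered j) ⟨
    j                                  ∎)
  where
  open DecMembership (Fin._≟_ {suc D}) using (_∈?_)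
  open ≡-Reasoning

-- Stage k + 1 recolours the elements of rank k, avoiding the current colours of their
-- conflicts. Elements are never recoloured later, so only conflicts of lower rank are
-- guaranteed to receive a different colour.
module Greedy {A : Set} (rank : A → ℕ) (N : ℕ) (rank<N : ∀ x → rank x < N)
              (D : ℕ) (conflicts : A → List A) (|conflicts|≤D : ∀ x → length (conflicts x) ≤ D)
              where

  private
    Colouring : Set
    Colouring = A → Fin (suc D)

    |map-conflicts|≤D : ∀ (f : Colouring) x → length (map f (conflicts x)) ≤ D
    |map-conflicts|≤D f x = subst (_≤ D) (sym (length-map f (conflicts x))) (|conflicts|≤D x)

    recolourRank : ℕ → Colouring → Colouring
    recolourRank k f x with rank x ≟ k
    ... | yes _ = proj₁ (freshColour (map f (conflicts x)) (|map-conflicts|≤D f x))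
    ... | no  _ = f x

    recolourRank-≢ : ∀ k f x → rank x ≢ k → recolourRank k f x ≡ f x
    recolourRank-≢ k f x rank≢k with rank x ≟ k
    ... | yes rank≡k = ⊥-elim (rank≢k rank≡k)
    ... | no  _      = refl

    recolourRank-fresh : ∀ k f x → rank x ≡ k → recolourRank k f x ∉ map f (conflicts x)
    recolourRank-fresh k f x rank≡k with rank x ≟ k
    ... | yes _      = proj₂ (freshColour (map f (conflicts x)) (|map-conflicts|≤D f x))
    ... | no rank≢k = ⊥-elim (rank≢k rank≡k)

    stage : ℕ → Colouring
    stage zero    _ = Fin.zero
    stage (suc k)   = recolourRank k (stage k)

    stage-≢ : ∀ k {u w} → u ∈ conflicts w → rank u < rank w → rank w < k → stage k u ≢ stage k w
    stage-≢ zero    _   _   ()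
    stage-≢ (suc k) {u} {w} u∈w u<w w<1+k with m<1+n⇒m<n∨m≡n w<1+k
    ... | inj₁ w<k
      rewrite recolourRank-≢ k (stage k) u (<⇒≢ (<-trans u<w w<k))
            | recolourRank-≢ k (stage k) w (<⇒≢ w<k)
      = stage-≢ k u∈w u<w w<k
    ... | inj₂ refl
      rewrite recolourRank-≢ k (stage k) u (<⇒≢ u<w)
      = λ same → recolourRank-fresh k (stage k) w refl
                   (subst (_∈ map (stage k) (conflicts w)) same (∈-map⁺ (stage k) u∈w))

  colour : Colouring
  colour = stage N

  colour-≢ : ∀ {u w} → u ∈ conflicts w → rank u < rank w → colour u ≢ colour w
  colour-≢ u∈w u<w = stage-≢ N u∈w u<w (rank<N _)

module _ (G : Graph) where

  Adj-sym : ∀ {u v} → Adj G u v → Adj G v u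
  Adj-sym {u} {v} u~v = trans (Graph.sym G v u) u~v

  Adj⇒≢ : ∀ {u v} → Adj G u v → u ≢ v
  Adj⇒≢ {u} u~u refl with trans (sym u~u) (irrefl G u)
  ... | ()

  neighbours : Vertex G → Subset (n G)
  neighbours v = tabulate (adj G v)

  ∈-neighbours⁻ : ∀ {v u} → u ∈ₛ neighbours v → Adj G v u
  ∈-neighbours⁻ {v} {u} u∈N = trans (sym (lookup∘tabulate (adj G v) u)) ([]=⇒lookup u∈N)

  neighbourColours⁺ : ∀ {k} (φ : Vertex G → Fin k) {v u} → Adj G v u →
                      φ u ∈ₛ neighbourColours G φ v
  neighbourColours⁺ φ {v} {u} v~u = lookup⇒[]= (φ u) (neighbourColours G φ v) (begin
    lookup (neighbourColours G φ v) (φ u) ≡⟨ lookup∘tabulate _ (φ u) ⟩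
    ⌊ some-neighbour-coloured-φu ⌋         ≡⟨ isYes≗does some-neighbour-coloured-φu ⟩
    does some-neighbour-coloured-φu        ≡⟨ dec-true some-neighbour-coloured-φu (u , v~u , refl) ⟩
    true                                    ∎)
    where
    open ≡-Reasoning
    some-neighbour-coloured-φu : Dec (∃ λ w → Adj G v w × φ w ≡ φ u)
    some-neighbour-coloured-φu = any? λ w → (adj G v w ≟ᵇ true) ×-dec (φ w Fin.≟ φ u)

  module _ (π : LinOrder G) where

    rank : Vertex G → ℕ
    rank v = toℕ (π ⟨$⟩ʳ v)

    rank-injective : ∀ {u v} → rank u ≡ rank v → u ≡ v
    rank-injective {u} {v} same = begin
      u                   ≡⟨ inverseˡ π ⟨
      π ⟨$⟩ˡ (π ⟨$⟩ʳ u) ≡⟨ cong (π ⟨$⟩ˡ_) (toℕ-injective same) ⟩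
      π ⟨$⟩ˡ (π ⟨$⟩ʳ v) ≡⟨ inverseˡ π ⟩
      v                   ∎
      where open ≡-Reasoning

    edge⇒Reach : ∀ {t u v} → 1 ≤ t → Adj G u v → rank u < rank v → Reach G π t v u
    edge⇒Reach 1≤t u~v u<v =
      <⇒≤ u<v , inj₂ ([] , (Adj⇒≢ u~v ∷ []) ∷ [] ∷ [] , u~v ∷ [-] , 1≤t , [])

    wedge⇒Reach : ∀ {t u x v} → 2 ≤ t → Adj G u x → Adj G x v → u ≢ v →
                  rank u < rank v → rank v < rank x → Reach G π t v u
    wedge⇒Reach 2≤t u~x x~v u≢v u<v v<x =
      <⇒≤ u<v , inj₂ (_ ∷ [] , (Adj⇒≢ u~x ∷ u≢v ∷ []) ∷ (Adj⇒≢ x~v ∷ []) ∷ [] ∷ [] ,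
                      u~x ∷ x~v ∷ [-] , 2≤t , v<x ∷ [])

module DynamicColouring (G : Graph) (π : LinOrder G) {d : ℕ}
                        (reach≤d : ∀ v → CardAtMost (Reach G π 2 v) d) (r : ℕ) where

  reachSet : Vertex G → Subset (n G)
  reachSet v = proj₁ (reach≤d v)

  Reach⇒∈reachSet : ∀ {v u} → Reach G π 2 v u → u ∈ₛ reachSet v
  Reach⇒∈reachSet = proj₁ (proj₂ (reach≤d _)) _

  selected : Vertex G → Subset (n G)
  selected v = first r (neighbours G v)

  selected⇒Adj : ∀ {v u} → u ∈ₛ selected v → Adj G v u
  selected⇒Adj = ∈-neighbours⁻ G ∘ first-⊆ r _

  ∣selected∣≡ : ∀ v → ∣ selected v ∣ ≡ r ⊓ deg G v
  ∣selected∣≡ v = ∣first∣≡ r (neighbours G v)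

  with-selected : Vertex G → List (Vertex G)
  with-selected v = v ∷ toList (selected v)

  conflicts : Vertex G → List (Vertex G)
  conflicts w = concatMap with-selected (toList (reachSet w))

  length-conflicts : ∀ w → length (conflicts w) ≤ d * suc r
  length-conflicts w = begin
    length (conflicts w)                 ≤⟨ length-concatMap-≤ with-selected |with-selected|≤1+r
                                              (toList (reachSet w)) ⟩
    length (toList (reachSet w)) * suc r ≡⟨ cong (_* suc r) (length-toList (reachSet w)) ⟩
    ∣ reachSet w ∣ * suc r               ≤⟨ *-monoˡ-≤ (suc r) (proj₂ (proj₂ (reach≤d w))) ⟩
    d * suc r                            ∎
    where
    open ≤-Reasoning
    |with-selected|≤1+r : ∀ v → length (with-selected v) ≤ suc r
    |with-selected|≤1+r v = s≤s (begin
      length (toList (selected v)) ≡⟨ length-toList (selected v) ⟩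
      ∣ selected v ∣               ≡⟨ ∣selected∣≡ v ⟩
      r ⊓ deg G v                  ≤⟨ m⊓n≤m r (deg G v) ⟩
      r                            ∎)

  reach⇒conflict : ∀ {w u} → u ∈ₛ reachSet w → u ∈ conflicts w
  reach⇒conflict {w} u∈R =
    ∈-concatMap⁺ with-selected (lose (∈-toList⁺ (reachSet w) u∈R) (here refl))

  selected⇒conflict : ∀ {w v u} → v ∈ₛ reachSet w → u ∈ₛ selected v → u ∈ conflicts w
  selected⇒conflict {w} {v} v∈R u∈S =
    ∈-concatMap⁺ with-selected
      (lose (∈-toList⁺ (reachSet w) v∈R) (there (∈-toList⁺ (selected v) u∈S)))

  edge⇒conflict : ∀ {u w} → Adj G u w → rank G π u < rank G π w → u ∈ conflicts w
  edge⇒conflict u~w u<w = reach⇒conflict (Reach⇒∈reachSet (edge⇒Reach G π (s≤s z≤n) u~w u<w))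

  selected-conflict : ∀ {v u w} → u ∈ₛ selected v → w ∈ₛ selected v → u ≢ w →
                      rank G π u < rank G π w → u ∈ conflicts w
  selected-conflict {v} {u} {w} u∈S w∈S u≢w u<w with <-cmp (rank G π v) (rank G π w)
  ... | tri< v<w _ _ = selected⇒conflict (Reach⇒∈reachSet
                         (edge⇒Reach G π (s≤s z≤n) (selected⇒Adj w∈S) v<w)) u∈S
  ... | tri≈ _ v≡w _ = ⊥-elim (Adj⇒≢ G (selected⇒Adj w∈S) (rank-injective G π v≡w))
  ... | tri> _ _ w<v = reach⇒conflict (Reach⇒∈reachSet
                         (wedge⇒Reach G π ≤-refl (Adj-sym G (selected⇒Adj u∈S)) (selected⇒Adj w∈S)
                                      u≢w u<w w<v))

  open Greedy (rank G π) (n G) (toℕ<n ∘ (π ⟨$⟩ʳ_)) (d * suc r) conflicts length-conflicts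
    renaming (colour to φ)

  separated : ∀ {u w} → u ≢ w →
              (rank G π u < rank G π w → u ∈ conflicts w) →
              (rank G π w < rank G π u → w ∈ conflicts u) → φ u ≢ φ w
  separated {u} {w} u≢w u<w⇒u∈w w<u⇒w∈u with <-cmp (rank G π u) (rank G π w)
  ... | tri< u<w _ _ = colour-≢ (u<w⇒u∈w u<w) u<w
  ... | tri≈ _ u≡w _ = ⊥-elim (u≢w (rank-injective G π u≡w))
  ... | tri> _ _ w<u = ≢-sym (colour-≢ (w<u⇒w∈u w<u) w<u)

  proper : Proper G φ
  proper u w u~w = separated (Adj⇒≢ G u~w) (edge⇒conflict u~w) (edge⇒conflict (Adj-sym G u~w))

  φ-injectiveOn-selected : ∀ v {u w} → u ∈ₛ selected v → w ∈ₛ selected v → φ u ≡ φ w → u ≡ w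
  φ-injectiveOn-selected v {u} {w} u∈S w∈S φu≡φw with u Fin.≟ w
  ... | yes u≡w = u≡w
  ... | no  u≢w = ⊥-elim (separated u≢w (selected-conflict u∈S w∈S u≢w)
                                        (selected-conflict w∈S u∈S (≢-sym u≢w)) φu≡φw)

  dynamic : IsDynamic r G φ
  dynamic = proper , λ v → begin
    r ⊓ deg G v                 ≡⟨ ∣selected∣≡ v ⟨
    ∣ selected v ∣              ≤⟨ injectiveOn⇒∣p∣≤∣q∣ (selected v) (neighbourColours G φ v) φ
                                     (neighbourColours⁺ G φ ∘ selected⇒Adj) (φ-injectiveOn-selected v) ⟩
    ∣ neighbourColours G φ v ∣ ∎
    where open ≤-Reasoning

  χ≤1+d[1+r] : ChiDynAtMost r G (suc (d * suc r))
  χ≤1+d[1+r] = suc (d * suc r) , ≤-refl , φ , dynamic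

ChiDynAtMost-mono : ∀ {r} G {k m} → k ≤ m → ChiDynAtMost r G k → ChiDynAtMost r G m
ChiDynAtMost-mono G k≤m (colours , colours≤k , φ , φ-dynamic) =
  colours , ≤-trans colours≤k k≤m , φ , φ-dynamic

1+d[1+r]≤[1+2d]r : ∀ d {r} → 1 ≤ r → suc (d * suc r) ≤ suc (d + d) * r
1+d[1+r]≤[1+2d]r d {r} 1≤r = begin
  suc (d * suc r)     ≡⟨ cong suc (*-suc d r) ⟩
  1 + (d + d * r)     ≤⟨ +-mono-≤ 1≤r (+-monoˡ-≤ (d * r) (m≤m*n d r {{>-nonZero 1≤r}})) ⟩
  r + (d * r + d * r) ≡⟨ cong (r +_) (*-distribʳ-+ r d d) ⟨
  suc (d + d) * r     ∎
  where open ≤-Reasoning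

corollary6 : (𝒢 : Graph → Set) → BoundedExpansion 𝒢 →
    ∃ λ (c : ℕ) → ∀ (G : Graph) → 𝒢 G → ∀ (r : ℕ) → 1 ≤ r → ChiDynAtMost r G (c * r)
corollary6 𝒢 bounded with bounded 2 (s≤s z≤n)
... | d , col₂≤d = suc (d + d) , χ≤
  where
  χ≤ : ∀ G → 𝒢 G → ∀ r → 1 ≤ r → ChiDynAtMost r G (suc (d + d) * r)
  χ≤ G G∈𝒢 r 1≤r =
    let π , reach≤d = col₂≤d G G∈𝒢
    in ChiDynAtMost-mono G (1+d[1+r]≤[1+2d]r d 1≤r) (DynamicColouring.χ≤1+d[1+r] G π reach≤d r)
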